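{- Let $G_n$ be the graph defined below. There is an absolute constant $C$ such that the independence number satisfies $\alpha(G_n) \leq C n$ for all $n \geq 1$, i.e. $\alpha(G_n) = O(n)$.
   Context: Let $Q_k=\{0,1\}^k$, $0^k$ and $1^k$ the all-zero and all-one vectors, $Q_k^- = Q_k\setminus\{0^k,1^k\}$, and for $X\subset Q_k$, $Y\subset Q_\ell$ let $X\times Y\subset Q_{k+\ell}$ be the set of concatenations $(x,y)$ with $x\in X$, $y\in Y$. Let $S = Q_7 \setminus \big[(1^4\times Q_3^-) \cup \{0^4\times 0^3\}\cup\{0^4\times 1^3\}\big]$. For a positive integer $n$, let $G_n$ be the graph with vertex set $[n]^7$, where for $x=(x_1,\dots,x_7)$, $y=(y_1,\dots,y_7)$ we define $\rho(x,y)\in Q_7$ by $\rho_i(x,y)=1$ if $x_i\neq y_i$ and $\rho_i(x,y)=0$ if $x_i=y_i$; two vertices $x,y$ are adjacent iff $\rho(x,y)\in S$. $\alpha$ denotes the independence number. -}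

module Defs where

open import Data.Nat using (ℕ)
open import Data.Bool using (Bool; true; false; not)
open import Data.Fin using (Fin)
open import Data.Fin.Properties using (_≟_)
open import Data.Vec using (Vec; replicate; zipWith; _++_)
open import Data.Product using (Σ; _×_)
open import Data.List using (List)
open import Data.List.Membership.Propositional using (_∈_)
open import Relation.Binary.PropositionalEquality using (_≡_; _≢_)
open import Relation.Nullary using (¬_)
open import Relation.Nullary.Decidable using (⌊_⌋)

-- Q_k = {0,1}^k, with 0 = false, 1 = true
Q : ℕ → Set
Q k = Vec Bool k

0ᵏ : (k : ℕ) → Q k
0ᵏ k = replicate k false

1ᵏ : (k : ℕ) → Q k
1ᵏ k = replicate k true

InQ⁻ : (k : ℕ) → Q k → Set
InQ⁻ k v = (v ≢ 0ᵏ k) × (v ≢ 1ᵏ k)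

In1⁴×Q₃⁻ : Q 7 → Set
In1⁴×Q₃⁻ r = Σ (Q 4) λ a → Σ (Q 3) λ b →
  (r ≡ a ++ b) × (a ≡ 1ᵏ 4) × InQ⁻ 3 b

InS : Q 7 → Set
InS r = (¬ In1⁴×Q₃⁻ r) × (r ≢ 0ᵏ 4 ++ 0ᵏ 3) × (r ≢ 0ᵏ 4 ++ 1ᵏ 3)

Vertex : ℕ → Set
Vertex n = Vec (Fin n) 7

ρ : {n : ℕ} → Vertex n → Vertex n → Q 7
ρ x y = zipWith (λ a b → not ⌊ a ≟ b ⌋) x y

Adj : {n : ℕ} → Vertex n → Vertex n → Set
Adj x y = InS (ρ x y)

Independent : {n : ℕ} → List (Vertex n) → Set
Independent I = ∀ x y → x ∈ I → y ∈ I → ¬ Adj x y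

module Submission where

open import Defs
open import Data.Nat using (ℕ; suc; _≤_; _*_)
open import Data.Nat.Properties using (_≤?_; ≰⇒>; ≤-trans; m≤m+n)
open import Data.Product using (Σ; ∃; _,_)
open import Data.List using (List; _∷_; length; lookup)
open import Data.List.Relation.Unary.Unique.Propositional using (Unique)
open import Data.List.Relation.Unary.AllPairs using (_∷_)
open import Data.List.Relation.Unary.All as All using ()
open import Data.List.Relation.Unary.Any using (any?)
open import Data.List.Membership.Propositional using (_∈_; find; lose)
open import Data.List.Membership.Propositional.Properties using (∈-lookup)
open import Data.Bool using (Bool; true; false; not)
import Data.Bool.Properties as Bool
open import Data.Fin using (Fin; zero; suc; combine; _↑ʳ_)
open import Data.Fin.Properties using (_≟_; pigeonhole; combine-injective; <⇒≢)
import Data.Fin.Properties as Fin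
import Data.Vec as Vec
open import Data.Vec using (Vec; []; _∷_; _++_)
open import Data.Vec.Properties using (≡-dec; lookup-zipWith; lookup-replicate)
open import Data.Vec.Relation.Binary.Pointwise.Extensional using (ext; Pointwise-≡⇒≡)
open import Data.Sum using (_⊎_; inj₁; inj₂)
open import Function using (_∘_)
open import Relation.Nullary using (¬_; yes; no; contradiction)
open import Relation.Nullary.Decidable using (⌊_⌋; ¬?; decidable-stable)
open import Relation.Binary.PropositionalEquality
  using (_≡_; _≢_; refl; sym; trans; cong; cong₂; ≢-sym; module ≡-Reasoning)

-- Two vertices are non-adjacent iff ρ lies in 1⁴×Q₃⁻ ∪ {0⁷, 0⁴1³}. Hence in an independent
-- set I two distinct vertices with the same first coordinate differ in all of the last three
-- coordinates, while two with different first coordinates agree in one of them. If only one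
-- first coordinate occurs in I, the fifth coordinate is injective on I. Otherwise fix g, h ∈ I
-- with different first coordinates, and give each x ∈ I the reference vertex r(x) ∈ {g, h}
-- whose first coordinate differs from that of x; r(x) depends on that coordinate only, so x
-- is determined by its first coordinate and an index among the last three at which it
-- agrees with r(x). Hence |I| ≤ 3n.

lookup-injective : ∀ {A : Set} {xs : List A} → Unique xs →
                   ∀ i j → lookup xs i ≡ lookup xs j → i ≡ j
lookup-injective {xs = _ ∷ _} _             zero    zero    _ = refl
lookup-injective {xs = _ ∷ _} (x∉xs ∷ _)    zero    (suc j) e = contradiction e (All.lookup x∉xs (∈-lookup j))
lookup-injective {xs = _ ∷ _} (x∉xs ∷ _)    (suc i) zero    e = contradiction (sym e) (All.lookup x∉xs (∈-lookup i))
lookup-injective {xs = _ ∷ _} (_ ∷ xs-uniq) (suc i) (suc j) e = cong suc (lookup-injective xs-uniq i j e)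

length≤-injectiveOn : ∀ {A : Set} {m} {xs : List A} (f : A → Fin m) → Unique xs →
                      (∀ {x y} → x ∈ xs → y ∈ xs → f x ≡ f y → x ≡ y) → length xs ≤ m
length≤-injectiveOn {m = m} {xs} f xs-uniq f-inj with length xs ≤? m
... | yes xs≤m = xs≤m
... | no xs≰m with i , j , i<j , fᵢ≡fⱼ ← pigeonhole (≰⇒> xs≰m) (f ∘ lookup xs) =
  contradiction (lookup-injective xs-uniq i j (f-inj (∈-lookup i) (∈-lookup j) fᵢ≡fⱼ)) (<⇒≢ i<j)

module KeyCoordinateBound {A : Set} {n k : ℕ} (key : A → Fin n) (coord : A → Fin (suc k) → Fin n) where

  Meet : A → A → Set
  Meet x y = ∃ λ i → coord x i ≡ coord y i

  meetingIndex : A → A → Fin (suc k)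
  meetingIndex x y with Fin.any? (λ i → coord x i ≟ coord y i)
  ... | yes (i , _) = i
  ... | no _ = zero

  meetingIndex-meets : ∀ {x y} → Meet x y → coord x (meetingIndex x y) ≡ coord y (meetingIndex x y)
  meetingIndex-meets {x} {y} x∼y with Fin.any? (λ i → coord x i ≟ coord y i)
  ... | yes (_ , p) = p
  ... | no x≁y = contradiction x∼y x≁y

  module _ {I : List A} (I-uniq : Unique I)
           (sameKey-apart : ∀ {x y} → x ∈ I → y ∈ I → key x ≡ key y → Meet x y → x ≡ y)
           (distinctKeys-meet : ∀ {x y} → x ∈ I → y ∈ I → key x ≢ key y → Meet x y) where

    length≤-constantKey : (∀ {x y} → x ∈ I → y ∈ I → key x ≡ key y) → length I ≤ n
    length≤-constantKey key-constant = length≤-injectiveOn (λ x → coord x zero) I-uniq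
      λ x∈I y∈I e → sameKey-apart x∈I y∈I (key-constant x∈I y∈I) (zero , e)

    length≤-twoKeys : ∀ {g h} → g ∈ I → h ∈ I → key g ≢ key h → length I ≤ suc k * n
    length≤-twoKeys {g} {h} g∈I h∈I g≢h = length≤-injectiveOn encode I-uniq encode-injective
      where
      reference : Fin n → A
      reference c with c ≟ key h
      ... | yes _ = g
      ... | no _ = h

      reference-∈ : ∀ c → reference c ∈ I
      reference-∈ c with c ≟ key h
      ... | yes _ = g∈I
      ... | no _ = h∈I

      reference-key≢ : ∀ c → key (reference c) ≢ c
      reference-key≢ c with c ≟ key h
      ... | yes c≡h = λ g≡c → g≢h (trans g≡c c≡h)
      ... | no c≢h = ≢-sym c≢h

      ref : A → A
      ref x = reference (key x)

      index : A → Fin (suc k)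
      index x = meetingIndex x (ref x)

      encode : A → Fin (suc k * n)
      encode x = combine (index x) (key x)

      meets-ref : ∀ {x} → x ∈ I → coord x (index x) ≡ coord (ref x) (index x)
      meets-ref {x} x∈I = meetingIndex-meets
        (distinctKeys-meet x∈I (reference-∈ (key x)) (≢-sym (reference-key≢ (key x))))

      encode-injective : ∀ {x y} → x ∈ I → y ∈ I → encode x ≡ encode y → x ≡ y
      encode-injective {x} {y} x∈I y∈I e with combine-injective (index x) (key x) (index y) (key y) e
      ... | iₓ≡iᵧ , kₓ≡kᵧ = sameKey-apart x∈I y∈I kₓ≡kᵧ (index x , coord-≡)
        where
        open ≡-Reasoning
        coord-≡ : coord x (index x) ≡ coord y (index x)
        coord-≡ = begin
          coord x (index x)       ≡⟨ meets-ref x∈I ⟩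
          coord (ref x) (index x) ≡⟨ cong₂ coord (cong reference kₓ≡kᵧ) iₓ≡iᵧ ⟩
          coord (ref y) (index y) ≡⟨ sym (meets-ref y∈I) ⟩
          coord y (index y)       ≡⟨ cong (coord y) (sym iₓ≡iᵧ) ⟩
          coord y (index x)       ∎

    length≤ : length I ≤ suc k * n
    length≤ with any? (λ x → any? (λ y → ¬? (key x ≟ key y)) I) I
    ... | yes ∃xy =
      let _ , x∈I , ∃y = find ∃xy
          _ , y∈I , x≢y = find ∃y
      in length≤-twoKeys x∈I y∈I x≢y
    ... | no ∄xy = ≤-trans (length≤-constantKey key-constant) (m≤m+n n (k * n))
      where
      key-constant : ∀ {x y} → x ∈ I → y ∈ I → key x ≡ key y
      key-constant {x} {y} x∈I y∈I =
        decidable-stable (key x ≟ key y) (λ x≢y → ∄xy (lose x∈I (lose y∈I x≢y)))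

true∷a++1³∈S : (a : Q 3) → InS (true ∷ a ++ 1ᵏ 3)
true∷a++1³∈S (b₂ ∷ b₃ ∷ b₄ ∷ []) = ∉1⁴×Q₃⁻ , (λ ()) , (λ ())
  where
  ∉1⁴×Q₃⁻ : ¬ In1⁴×Q₃⁻ (true ∷ b₂ ∷ b₃ ∷ b₄ ∷ 1ᵏ 3)
  ∉1⁴×Q₃⁻ (.(1ᵏ 4) , _ ∷ _ ∷ _ ∷ [] , refl , refl , _ , b≢1³) = b≢1³ refl

∉S-headTrue : (r : Q 7) → ¬ InS r → Vec.lookup r zero ≡ true → ∃ λ i → Vec.lookup r (4 ↑ʳ i) ≡ false
∉S-headTrue (true ∷ _ ∷ _ ∷ _ ∷ false ∷ _ ∷ _ ∷ []) _ refl = zero , refl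
∉S-headTrue (true ∷ _ ∷ _ ∷ _ ∷ true ∷ false ∷ _ ∷ []) _ refl = suc zero , refl
∉S-headTrue (true ∷ _ ∷ _ ∷ _ ∷ true ∷ true ∷ false ∷ []) _ refl = suc (suc zero) , refl
∉S-headTrue (true ∷ b₂ ∷ b₃ ∷ b₄ ∷ true ∷ true ∷ true ∷ []) r∉S refl =
  contradiction (true∷a++1³∈S (b₂ ∷ b₃ ∷ b₄ ∷ [])) r∉S

In1⁴×Q₃⁻⇒head≡true : ∀ {r} → In1⁴×Q₃⁻ r → Vec.lookup r zero ≡ true
In1⁴×Q₃⁻⇒head≡true (.(1ᵏ 4) , _ , refl , refl , _) = refl

∉S-headFalse : (r : Q 7) → ¬ InS r → Vec.lookup r zero ≡ false →
               r ≡ 0ᵏ 4 ++ 0ᵏ 3 ⊎ r ≡ 0ᵏ 4 ++ 1ᵏ 3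
∉S-headFalse r r∉S r₀≡false with ≡-dec Bool._≟_ r (0ᵏ 4 ++ 0ᵏ 3) | ≡-dec Bool._≟_ r (0ᵏ 4 ++ 1ᵏ 3)
... | yes r≡0⁷ | _ = inj₁ r≡0⁷
... | no _ | yes r≡0⁴1³ = inj₂ r≡0⁴1³
... | no r≢0⁷ | no r≢0⁴1³ = contradiction (∉1⁴×Q₃⁻ , r≢0⁷ , r≢0⁴1³) r∉S
  where
  ∉1⁴×Q₃⁻ : ¬ In1⁴×Q₃⁻ r
  ∉1⁴×Q₃⁻ r∈ = contradiction (trans (sym r₀≡false) (In1⁴×Q₃⁻⇒head≡true r∈)) λ ()

mismatch : ∀ {n} → Fin n → Fin n → Bool
mismatch a b = not ⌊ a ≟ b ⌋

module _ {n : ℕ} {a b : Fin n} where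

  mismatch-≡ : a ≡ b → mismatch a b ≡ false
  mismatch-≡ a≡b with a ≟ b
  ... | yes _ = refl
  ... | no a≢b = contradiction a≡b a≢b

  mismatch-≢ : a ≢ b → mismatch a b ≡ true
  mismatch-≢ a≢b with a ≟ b
  ... | yes a≡b = contradiction a≡b a≢b
  ... | no _ = refl

  mismatch-false⁻¹ : mismatch a b ≡ false → a ≡ b
  mismatch-false⁻¹ _ with a ≟ b
  mismatch-false⁻¹ _  | yes a≡b = a≡b
  mismatch-false⁻¹ () | no _

lastThree : ∀ {n} → Vertex n → Fin 3 → Fin n
lastThree x i = Vec.lookup x (4 ↑ʳ i)

module _ {n : ℕ} {x y : Vertex n} where

  ρ-lookup : ∀ i → Vec.lookup (ρ x y) i ≡ mismatch (Vec.lookup x i) (Vec.lookup y i)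
  ρ-lookup i = lookup-zipWith mismatch i x y

  ρ≡0⇒≡ : ρ x y ≡ 0ᵏ 4 ++ 0ᵏ 3 → x ≡ y
  ρ≡0⇒≡ ρ≡0 = Pointwise-≡⇒≡ (ext λ i → mismatch-false⁻¹ (begin
    mismatch (Vec.lookup x i) (Vec.lookup y i) ≡⟨ sym (ρ-lookup i) ⟩
    Vec.lookup (ρ x y) i                       ≡⟨ cong (λ r → Vec.lookup r i) ρ≡0 ⟩
    Vec.lookup (Vec.replicate 7 false) i       ≡⟨ lookup-replicate i false ⟩
    false                                      ∎))
    where open ≡-Reasoning

  nonAdjacent-sameHead-apart : ¬ Adj x y → Vec.lookup x zero ≡ Vec.lookup y zero →
                               (∃ λ i → lastThree x i ≡ lastThree y i) → x ≡ y
  nonAdjacent-sameHead-apart x≁y x₀≡y₀ (i , xᵢ≡yᵢ)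
    with ∉S-headFalse (ρ x y) x≁y (trans (ρ-lookup zero) (mismatch-≡ x₀≡y₀))
  ... | inj₁ ρ≡0⁷ = ρ≡0⇒≡ ρ≡0⁷
  ... | inj₂ ρ≡0⁴1³ = contradiction (begin
    false                                    ≡⟨ sym (mismatch-≡ xᵢ≡yᵢ) ⟩
    mismatch (lastThree x i) (lastThree y i) ≡⟨ sym (ρ-lookup (4 ↑ʳ i)) ⟩
    Vec.lookup (ρ x y) (4 ↑ʳ i)              ≡⟨ cong (λ r → Vec.lookup r (4 ↑ʳ i)) ρ≡0⁴1³ ⟩
    Vec.lookup (1ᵏ 3) i                      ≡⟨ lookup-replicate i true ⟩
    true                                     ∎) λ ()
    where open ≡-Reasoning

  nonAdjacent-distinctHeads-meet : ¬ Adj x y → Vec.lookup x zero ≢ Vec.lookup y zero →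
                                   ∃ λ i → lastThree x i ≡ lastThree y i
  nonAdjacent-distinctHeads-meet x≁y x₀≢y₀
    with i , ρᵢ≡false ← ∉S-headTrue (ρ x y) x≁y (trans (ρ-lookup zero) (mismatch-≢ x₀≢y₀)) =
    i , mismatch-false⁻¹ (trans (sym (ρ-lookup (4 ↑ʳ i))) ρᵢ≡false)

proposition2p1 : Σ ℕ λ C → ∀ n → 1 ≤ n → ∀ I → Unique I → Independent {n} I → length I ≤ C * n
proposition2p1 = 3 , bound
  where
  bound : ∀ n → 1 ≤ n → ∀ I → Unique I → Independent {n} I → length I ≤ 3 * n
  bound n _ I I-uniq I-indep = length≤ I-uniq
    (λ x∈I y∈I → nonAdjacent-sameHead-apart (I-indep _ _ x∈I y∈I))
    (λ x∈I y∈I → nonAdjacent-distinctHeads-meet (I-indep _ _ x∈I y∈I))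
    where open KeyCoordinateBound {n = n} (λ x → Vec.lookup x zero) lastThree
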